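{- In the non-preemptive mUETS problem, the following online algorithm is $O(\sqrt{m})$-competitive (i.e., there is an absolute constant $C$ such that its makespan is at most $C\sqrt{m}$ times the optimal makespan on every instance): let $k=\lfloor\sqrt m\rfloor$; compute a partition $(X_1,\dots,X_k)$ of $J$ into $k$ (possibly empty) parts minimizing $\max_{i\in[k]}c(X_i)$; assign each batch $X_i$, $i\in[k]$, to its own set of $\lfloor m/k\rfloor$ machines.
   Context: Non-preemptive mUETS: a finite set $J$ of $n$ jobs and $m$ identical machines, $n\ge m\ge 2$, all jobs available at time $0$. A known setup-time function $c:2^J\to\mathbb{R}_{\ge0}$ is monotone ($c(X)\le c(Y)$ for $X\subseteq Y$) and subadditive ($c(X)+c(Y)\ge c(X\cup Y)$ for disjoint $X,Y$). Each job $j$ has execution time $p_j\ge0$, unknown to an online algorithm until $j$ completes; $p(X)=\sum_{j\in X}p_j$. An algorithm forms batches (sets of jobs not completed and not assigned elsewhere) and may assign a batch $X$ to $k\ge1$ idle machines; each of these machines incurs setup time $c(X)$ and the jobs of $X$ are executed first-come first-served among them, so the batch is completed between $c(X)+p(X)/k$ and $c(X)+p(X)/k+\max_{j\in X}p_j$ time units after it starts. Batches are processed to completion without interruption. The makespan is the completion time of all jobs. The optimal makespan is $\min_{(X_1,\dots,X_m)\text{ partition of }J}\max_i(c(X_i)+p(X_i))$. An algorithm is $\rho$-competitive if its makespan is at most $\rho$ times the optimal makespan on every instance.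
   Formalization: The setup-time function c and the execution times $p_j$ take values in the nonnegative rationals instead of $\mathbb{R}_{\ge0}$. -}

module Defs where

open import Data.Nat as ℕ using (ℕ; zero; suc)
open import Data.Nat.DivMod using (_/_)
open import Data.Fin using (Fin; zero; suc; _≟_)
open import Data.Fin.Subset using (Subset; _∈_; _∉_; _⊆_; _∪_; inside; outside)
open import Data.Vec using (Vec; tabulate; lookup)
open import Data.Bool using (Bool; true; false; if_then_else_)
open import Data.Integer using (+_)
open import Data.Rational as ℚ using (ℚ; 0ℚ; _+_; _*_; _⊔_; _≤_)
open import Relation.Nullary.Decidable using (⌊_⌋)
open import Data.Product using (_×_)

ℕ→ℚ : ℕ → ℚ
ℕ→ℚ q = + q ℚ./ 1

sumFin : (n : ℕ) → (Fin n → ℚ) → ℚ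
sumFin zero    f = 0ℚ
sumFin (suc n) f = f zero + sumFin n (λ i → f (suc i))

-- maximum over all indices of Fin n (0 for n = 0; all values used are ≥ 0)
maxFin : (n : ℕ) → (Fin n → ℚ) → ℚ
maxFin zero    f = 0ℚ
maxFin (suc n) f = f zero ⊔ maxFin n (λ i → f (suc i))

pSum : {n : ℕ} → (Fin n → ℚ) → Subset n → ℚ
pSum {n} p X = sumFin n (λ j → if lookup X j then p j else 0ℚ)

pMax : {n : ℕ} → (Fin n → ℚ) → Subset n → ℚ
pMax {n} p X = maxFin n (λ j → if lookup X j then p j else 0ℚ)

-- A partition of J = Fin n into r (possibly empty) ordered parts is given by
-- a labelling f : Fin n → Fin r; its i-th part is
part : {n r : ℕ} → (Fin n → Fin r) → Fin r → Subset n
part f i = tabulate (λ j → ⌊ f j ≟ i ⌋)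

Disjoint : {n : ℕ} → Subset n → Subset n → Set
Disjoint X Y = ∀ j → j ∈ X → j ∉ Y

Monotone : {n : ℕ} → (Subset n → ℚ) → Set
Monotone c = ∀ X Y → X ⊆ Y → c X ≤ c Y

Subadditive : {n : ℕ} → (Subset n → ℚ) → Set
Subadditive c = ∀ X Y → Disjoint X Y → c (X ∪ Y) ≤ c X + c Y

maxSetup : {n r : ℕ} → (Subset n → ℚ) → (Fin n → Fin r) → ℚ
maxSetup {r = r} c f = maxFin r (λ i → c (part f i))

-- cost of an offline schedule (partition onto r machines): max_i (c(X_i) + p(X_i))
schedCost : {n r : ℕ} → (Subset n → ℚ) → (Fin n → ℚ) → (Fin n → Fin r) → ℚ
schedCost {r = r} c p g = maxFin r (λ i → c (part g i) + pSum p (part g i))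

-- A batch X run on q machines (all starting at time 0) completes at a time T with
--   c(X) + p(X)/q ≤ T ≤ c(X) + p(X)/q + max_{j∈X} p_j ,
-- written here multiplied through by q ≥ 1.
BatchCompletion : {n : ℕ} → (Subset n → ℚ) → (Fin n → ℚ) → ℕ → Subset n → ℚ → Set
BatchCompletion c p q X T =
  (ℕ→ℚ q * c X + pSum p X ≤ ℕ→ℚ q * T) ×
  (ℕ→ℚ q * T ≤ ℕ→ℚ q * c X + pSum p X + ℕ→ℚ q * pMax p X)

-- Let O be the cost of an arbitrary schedule g on the m machines. Cutting the
-- machines of g into k groups of k + 2 consecutive ones (possible as
-- m < (k + 1)²) yields a k-partition whose parts are unions of at most k + 2
-- parts of g, so by monotonicity and subadditivity its maximal setup time is at
-- most (k + 3)·O, and by optimality of the chosen partition so is every c(Xᵢ).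
-- Moreover p(Xᵢ) ≤ p(J) ≤ (m + 1)·O and every pⱼ ≤ O. A batch run on
-- q = ⌊m/k⌋ ≥ k machines thus completes by c(Xᵢ) + p(Xᵢ)/q + maxⱼ pⱼ ≤ 9k·O,
-- and k² ≤ m turns this into the bound with C = 9.
module Submission where

open import Defs
open import Algebra.Bundles using (CommutativeMonoid)
open import Data.Bool using (true; false; if_then_else_; _∨_)
open import Data.Bool.Properties using (T-≡)
open import Data.Empty using (⊥-elim)
open import Data.Fin using (Fin; zero; suc; toℕ; fromℕ<; _≟_)
open import Data.Fin.Properties using (toℕ<n; toℕ-fromℕ<; toℕ-injective)
open import Data.Fin.Subset using (Subset; _∈_; _⊆_; _∪_; ⊥)
open import Data.Fin.Subset.Properties using (x∈p∪q⁻; x∈p∪q⁺; ⊥⊆; ∉⊥)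
open import Data.Integer as ℤ using (+_)
import Data.Integer.Properties as ℤ
open import Data.Nat as ℕ using (ℕ; zero; suc; NonZero; _≤_; _<_)
import Data.Nat.Properties as ℕ
open import Data.Nat.Coprimality using (1-coprimeTo)
import Data.Nat.Coprimality as Coprime
open import Data.Nat.DivMod using (_/_; _%_; m≡m%n+[m/n]*n; m%n<n; m/n*n≤m; m*n/n≡m; /-monoˡ-≤; m<n*o⇒m/o<n)
open import Data.Nat.Tactic.RingSolver using (solve-∀)
open import Data.Product using (Σ; ∃-syntax; _,_)
open import Data.Rational as ℚ using (ℚ; mkℚ; 0ℚ; _+_; _*_; NonNegative; Positive)
import Data.Rational.Properties as ℚ
open import Data.Rational.Solver using (module +-*-Solver)
open import Algebra.Properties.CommutativeSemigroup (CommutativeMonoid.commutativeSemigroup ℚ.+-0-commutativeMonoid)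
  using () renaming (interchange to +-interchange)
open import Data.Sum using (inj₁; inj₂)
open import Data.Vec using (tabulate; lookup)
open import Data.Vec.Properties using ([]=⇒lookup; lookup⇒[]=; lookup∘tabulate; lookup-zipWith)
open import Function using (_∘_; Equivalence)
open import Level using (0ℓ)
open import Relation.Binary.PropositionalEquality using (_≡_; refl; sym; trans; cong; cong₂; subst; ≢-sym; module ≡-Reasoning)
open import Relation.Nullary using (yes; no; contradiction)
open import Relation.Nullary.Decidable using (⌊_⌋; toWitness; fromWitness)
open import Relation.Unary using (Pred; Decidable)

open Equivalence using (to; from)

-- ℕ→ℚ a = + a / 1 is stuck on a gcd; on canonical forms the rational + and *
-- unfold to a single division, which /-cong handles.
ℕ→ℚ≡mkℚ : ∀ a → ℕ→ℚ a ≡ mkℚ (+ a) 0 (Coprime.sym (1-coprimeTo a))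
ℕ→ℚ≡mkℚ a = ℚ.↥p/↧p≡p _

ℕ→ℚ-+ : ∀ a b → ℕ→ℚ (a ℕ.+ b) ≡ ℕ→ℚ a + ℕ→ℚ b
ℕ→ℚ-+ a b rewrite ℕ→ℚ≡mkℚ a | ℕ→ℚ≡mkℚ b =
  ℚ./-cong (trans (ℤ.pos-+ a b) (sym (cong₂ ℤ._+_ (ℤ.*-identityʳ (+ a)) (ℤ.*-identityʳ (+ b))))) refl

ℕ→ℚ-* : ∀ a b → ℕ→ℚ (a ℕ.* b) ≡ ℕ→ℚ a * ℕ→ℚ b
ℕ→ℚ-* a b rewrite ℕ→ℚ≡mkℚ a | ℕ→ℚ≡mkℚ b = ℚ./-cong (ℤ.pos-* a b) refl

ℕ→ℚ-mono-≤ : ∀ {a b} → a ≤ b → ℕ→ℚ a ℚ.≤ ℕ→ℚ b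
ℕ→ℚ-mono-≤ {a} {b} a≤b rewrite ℕ→ℚ≡mkℚ a | ℕ→ℚ≡mkℚ b = ℚ.*≤* (ℤ.*-monoʳ-≤-nonNeg (+ 1) (ℤ.+≤+ a≤b))

ℕ→ℚ-nonNeg : ∀ a → NonNegative (ℕ→ℚ a)
ℕ→ℚ-nonNeg a = ℚ.normalize-nonNeg a 1

ℕ→ℚ-pos : ∀ a .{{_ : NonZero a}} → Positive (ℕ→ℚ a)
ℕ→ℚ-pos (suc a) = ℚ.normalize-pos (suc a) 1

ℕ→ℚ-*-cancelˡ-≤ : ∀ a .{{_ : NonZero a}} {x y} → ℕ→ℚ a * x ℚ.≤ ℕ→ℚ a * y → x ℚ.≤ y
ℕ→ℚ-*-cancelˡ-≤ a = ℚ.*-cancelˡ-≤-pos (ℕ→ℚ a) {{ℕ→ℚ-pos a}}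

ℕ→ℚ-*-monoˡ-≤ : ∀ a {x y} → x ℚ.≤ y → ℕ→ℚ a * x ℚ.≤ ℕ→ℚ a * y
ℕ→ℚ-*-monoˡ-≤ a = ℚ.*-monoˡ-≤-nonNeg (ℕ→ℚ a) {{ℕ→ℚ-nonNeg a}}

ℕ→ℚ-*-nonNeg : ∀ a {x} → 0ℚ ℚ.≤ x → 0ℚ ℚ.≤ ℕ→ℚ a * x
ℕ→ℚ-*-nonNeg a {x} x≥0 = subst (ℚ._≤ ℕ→ℚ a * x) (ℚ.*-zeroʳ (ℕ→ℚ a)) (ℕ→ℚ-*-monoˡ-≤ a x≥0)

sumFin-mono-≤ : ∀ n {f g : Fin n → ℚ} → (∀ i → f i ℚ.≤ g i) → sumFin n f ℚ.≤ sumFin n g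
sumFin-mono-≤ zero    f≤g = ℚ.≤-refl
sumFin-mono-≤ (suc n) f≤g = ℚ.+-mono-≤ (f≤g zero) (sumFin-mono-≤ n (f≤g ∘ suc))

sumFin-nonNeg : ∀ n {f : Fin n → ℚ} → (∀ i → 0ℚ ℚ.≤ f i) → 0ℚ ℚ.≤ sumFin n f
sumFin-nonNeg zero    f≥0 = ℚ.≤-refl
sumFin-nonNeg (suc n) f≥0 = ℚ.+-mono-≤ (f≥0 zero) (sumFin-nonNeg n (f≥0 ∘ suc))

sumFin-+ : ∀ n (f g : Fin n → ℚ) → sumFin n (λ i → f i + g i) ≡ sumFin n f + sumFin n g
sumFin-+ zero    f g = refl
sumFin-+ (suc n) f g = begin
  (f zero + g zero) + sumFin n (λ i → f (suc i) + g (suc i))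
    ≡⟨ cong₂ _+_ (refl {x = f zero + g zero}) (sumFin-+ n (f ∘ suc) (g ∘ suc)) ⟩
  (f zero + g zero) + (sumFin n (f ∘ suc) + sumFin n (g ∘ suc))
    ≡⟨ +-interchange (f zero) (g zero) (sumFin n (f ∘ suc)) (sumFin n (g ∘ suc)) ⟩
  (f zero + sumFin n (f ∘ suc)) + (g zero + sumFin n (g ∘ suc)) ∎
  where open ≡-Reasoning

term≤sumFin : ∀ n {f : Fin n → ℚ} → (∀ i → 0ℚ ℚ.≤ f i) → ∀ i → f i ℚ.≤ sumFin n f
term≤sumFin (suc n) {f} f≥0 zero = begin
  f zero               ≡⟨ ℚ.+-identityʳ (f zero) ⟨
  f zero + 0ℚ          ≤⟨ ℚ.+-monoʳ-≤ (f zero) (sumFin-nonNeg n (f≥0 ∘ suc)) ⟩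
  sumFin (suc n) f     ∎
  where open ℚ.≤-Reasoning
term≤sumFin (suc n) {f} f≥0 (suc i) = begin
  f (suc i)            ≡⟨ ℚ.+-identityˡ (f (suc i)) ⟨
  0ℚ + f (suc i)       ≤⟨ ℚ.+-mono-≤ (f≥0 zero) (term≤sumFin n (f≥0 ∘ suc) i) ⟩
  sumFin (suc n) f     ∎
  where open ℚ.≤-Reasoning

maxFin-nonNeg : ∀ n (f : Fin n → ℚ) → 0ℚ ℚ.≤ maxFin n f
maxFin-nonNeg zero    f = ℚ.≤-refl
maxFin-nonNeg (suc n) f = ℚ.≤-trans (maxFin-nonNeg n (f ∘ suc)) (ℚ.p≤q⊔p (f zero) _)

term≤maxFin : ∀ n (f : Fin n → ℚ) i → f i ℚ.≤ maxFin n f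
term≤maxFin (suc n) f zero    = ℚ.p≤p⊔q (f zero) _
term≤maxFin (suc n) f (suc i) = ℚ.≤-trans (term≤maxFin n (f ∘ suc) i) (ℚ.p≤q⊔p (f zero) _)

maxFin-lub : ∀ n {f : Fin n → ℚ} {B} → 0ℚ ℚ.≤ B → (∀ i → f i ℚ.≤ B) → maxFin n f ℚ.≤ B
maxFin-lub zero    B≥0 f≤B = B≥0
maxFin-lub (suc n) B≥0 f≤B = ℚ.⊔-lub (f≤B zero) (maxFin-lub n B≥0 (f≤B ∘ suc))

module _ {n} {P : Pred (Fin n) 0ℓ} (P? : Decidable P) where

  ∈tabulate⁺ : ∀ {j} → P j → j ∈ tabulate (λ i → ⌊ P? i ⌋)
  ∈tabulate⁺ {j} pj = lookup⇒[]= j _ (trans (lookup∘tabulate _ j) (T-≡ .to (fromWitness pj)))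

  ∈tabulate⁻ : ∀ {j} → j ∈ tabulate (λ i → ⌊ P? i ⌋) → P j
  ∈tabulate⁻ {j} j∈ = toWitness (T-≡ .from (trans (sym (lookup∘tabulate _ j)) ([]=⇒lookup j∈)))

module _ {n r} (f : Fin n → Fin r) {i : Fin r} {j : Fin n} where

  ∈part⁺ : f j ≡ i → j ∈ part f i
  ∈part⁺ = ∈tabulate⁺ (λ j → f j ≟ i)

  ∈part⁻ : j ∈ part f i → f j ≡ i
  ∈part⁻ = ∈tabulate⁻ (λ j → f j ≟ i)

restrict : ∀ {n} → (Fin n → ℚ) → Subset n → Fin n → ℚ
restrict p X j = if lookup X j then p j else 0ℚ

module _ {n} {p : Fin n → ℚ} (p≥0 : ∀ j → 0ℚ ℚ.≤ p j) where

  restrict-nonNeg : ∀ X j → 0ℚ ℚ.≤ restrict p X j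
  restrict-nonNeg X j with lookup X j
  ... | true  = p≥0 j
  ... | false = ℚ.≤-refl

  restrict-mono-⊆ : ∀ {X Y} → X ⊆ Y → ∀ j → restrict p X j ℚ.≤ restrict p Y j
  restrict-mono-⊆ {X} {Y} X⊆Y j with lookup X j in X[j]
  ... | false = restrict-nonNeg Y j
  ... | true rewrite []=⇒lookup (X⊆Y (lookup⇒[]= j X X[j])) = ℚ.≤-refl

  restrict-∪ : ∀ X Y j → restrict p (X ∪ Y) j ℚ.≤ restrict p X j + restrict p Y j
  restrict-∪ X Y j rewrite lookup-zipWith _∨_ j X Y with lookup X j | lookup Y j
  ... | true  | true  = ℚ.≤-trans (ℚ.≤-reflexive (sym (ℚ.+-identityʳ (p j)))) (ℚ.+-monoʳ-≤ (p j) (p≥0 j))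
  ... | true  | false = ℚ.≤-reflexive (sym (ℚ.+-identityʳ (p j)))
  ... | false | true  = ℚ.≤-reflexive (sym (ℚ.+-identityˡ (p j)))
  ... | false | false = ℚ.≤-refl

  pSum-nonNeg : ∀ X → 0ℚ ℚ.≤ pSum p X
  pSum-nonNeg X = sumFin-nonNeg n (restrict-nonNeg X)

  pSum-monotone : Monotone (pSum p)
  pSum-monotone X Y X⊆Y = sumFin-mono-≤ n (restrict-mono-⊆ X⊆Y)

  pSum-subadditive : Subadditive (pSum p)
  pSum-subadditive X Y _ = ℚ.≤-trans (sumFin-mono-≤ n (restrict-∪ X Y)) (ℚ.≤-reflexive (sumFin-+ n _ _))

  ∈⇒≤pSum : ∀ {X j} → j ∈ X → p j ℚ.≤ pSum p X
  ∈⇒≤pSum {X} {j} j∈X = subst (ℚ._≤ pSum p X) restrict[j]≡p[j] (term≤sumFin n (restrict-nonNeg X) j)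
    where
    restrict[j]≡p[j] : restrict p X j ≡ p j
    restrict[j]≡p[j] rewrite []=⇒lookup j∈X = refl

pMax-lub : ∀ {n} {p : Fin n → ℚ} {B} → 0ℚ ℚ.≤ B → (∀ j → p j ℚ.≤ B) → ∀ X → pMax p X ℚ.≤ B
pMax-lub {n} {p} {B} B≥0 p≤B X = maxFin-lub n B≥0 restrict≤B
  where
  restrict≤B : ∀ j → restrict p X j ℚ.≤ B
  restrict≤B j with lookup X j
  ... | true  = p≤B j
  ... | false = B≥0

module _ {n} (h : Fin n → ℕ) where

  fibre : ℕ → Subset n
  fibre l = tabulate (λ j → ⌊ h j ℕ.≟ l ⌋)

  ∈fibre⁺ : ∀ {l j} → h j ≡ l → j ∈ fibre l
  ∈fibre⁺ {l} = ∈tabulate⁺ (λ j → h j ℕ.≟ l)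

  ∈fibre⁻ : ∀ {l j} → j ∈ fibre l → h j ≡ l
  ∈fibre⁻ {l} = ∈tabulate⁻ (λ j → h j ℕ.≟ l)

  window : ℕ → ℕ → Subset n
  window a zero    = ⊥
  window a (suc t) = fibre a ∪ window (suc a) t

  window-lower : ∀ a t {j} → j ∈ window a t → a ≤ h j
  window-lower a zero    j∈ = ⊥-elim (∉⊥ j∈)
  window-lower a (suc t) j∈ with x∈p∪q⁻ (fibre a) (window (suc a) t) j∈
  ... | inj₁ j∈fibre  = ℕ.≤-reflexive (sym (∈fibre⁻ j∈fibre))
  ... | inj₂ j∈window = ℕ.<⇒≤ (window-lower (suc a) t j∈window)

  ∈window : ∀ a t {j} → a ≤ h j → h j < a ℕ.+ t → j ∈ window a t
  ∈window a zero    a≤h h<a = contradiction (subst (h _ <_) (ℕ.+-identityʳ a) h<a) (ℕ.≤⇒≯ a≤h)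
  ∈window a (suc t) {j} a≤h h<a+t with h j ℕ.≟ a
  ... | yes h≡a = x∈p∪q⁺ (inj₁ (∈fibre⁺ h≡a))
  ... | no  h≢a = x∈p∪q⁺ (inj₂ (∈window (suc a) t (ℕ.≤∧≢⇒< a≤h (≢-sym h≢a)) (subst (h j <_) (ℕ.+-suc a t) h<a+t)))

  fibre-disjoint-window : ∀ a t → Disjoint (fibre a) (window (suc a) t)
  fibre-disjoint-window a t j j∈fibre j∈window = ℕ.<⇒≢ (window-lower (suc a) t j∈window) (sym (∈fibre⁻ j∈fibre))

  -- The extra B pays for φ ⊥, which need not vanish.
  window-bound : {φ : Subset n → ℚ} → Monotone φ → Subadditive φ → ∀ {B} →
    (∀ l → φ (fibre l) ℚ.≤ B) → ∀ a t → φ (window a t) ℚ.≤ ℕ→ℚ (suc t) * B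
  window-bound {φ} mono sub {B} φ-fibre≤B a zero = begin
    φ ⊥            ≤⟨ mono ⊥ (fibre a) ⊥⊆ ⟩
    φ (fibre a)    ≤⟨ φ-fibre≤B a ⟩
    B              ≡⟨ ℚ.*-identityˡ B ⟨
    ℕ→ℚ 1 * B      ∎
    where open ℚ.≤-Reasoning
  window-bound {φ} mono sub {B} φ-fibre≤B a (suc t) = begin
    φ (fibre a ∪ window (suc a) t)            ≤⟨ sub _ _ (fibre-disjoint-window a t) ⟩
    φ (fibre a) + φ (window (suc a) t)        ≤⟨ ℚ.+-mono-≤ (φ-fibre≤B a) (window-bound mono sub φ-fibre≤B (suc a) t) ⟩
    B + ℕ→ℚ (suc t) * B                       ≡⟨ cong₂ _+_ (ℚ.*-identityˡ B) refl ⟨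
    ℕ→ℚ 1 * B + ℕ→ℚ (suc t) * B               ≡⟨ ℚ.*-distribʳ-+ B (ℕ→ℚ 1) (ℕ→ℚ (suc t)) ⟨
    (ℕ→ℚ 1 + ℕ→ℚ (suc t)) * B                 ≡⟨ cong (_* B) (ℕ→ℚ-+ 1 (suc t)) ⟨
    ℕ→ℚ (suc (suc t)) * B                     ∎
    where open ℚ.≤-Reasoning

module _ {n m} {c : Subset n → ℚ} {p : Fin n → ℚ}
         (c≥0 : ∀ X → 0ℚ ℚ.≤ c X) (p≥0 : ∀ j → 0ℚ ℚ.≤ p j) (g : Fin n → Fin m) where

  c-part≤schedCost : ∀ l → c (part g l) ℚ.≤ schedCost c p g
  c-part≤schedCost l = begin
    c (part g l)                       ≡⟨ ℚ.+-identityʳ _ ⟨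
    c (part g l) + 0ℚ                  ≤⟨ ℚ.+-monoʳ-≤ (c (part g l)) (pSum-nonNeg p≥0 (part g l)) ⟩
    c (part g l) + pSum p (part g l)   ≤⟨ term≤maxFin m _ l ⟩
    schedCost c p g                    ∎
    where open ℚ.≤-Reasoning

  pSum-part≤schedCost : ∀ l → pSum p (part g l) ℚ.≤ schedCost c p g
  pSum-part≤schedCost l = begin
    pSum p (part g l)                  ≡⟨ ℚ.+-identityˡ _ ⟨
    0ℚ + pSum p (part g l)             ≤⟨ ℚ.+-monoˡ-≤ (pSum p (part g l)) (c≥0 (part g l)) ⟩
    c (part g l) + pSum p (part g l)   ≤⟨ term≤maxFin m _ l ⟩
    schedCost c p g                    ∎
    where open ℚ.≤-Reasoning

  p≤schedCost : ∀ j → p j ℚ.≤ schedCost c p g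
  p≤schedCost j = ℚ.≤-trans (∈⇒≤pSum p≥0 (∈part⁺ g refl)) (pSum-part≤schedCost (g j))

module _ {n m} (g : Fin n → Fin m) where

  fibre-toℕ⊆part : Fin m → ∀ l → ∃[ l′ ] fibre (toℕ ∘ g) l ⊆ part g l′
  fibre-toℕ⊆part l₀ l with l ℕ.<? m
  ... | yes l<m = fromℕ< l<m , λ j∈ →
    ∈part⁺ g (toℕ-injective (trans (∈fibre⁻ (toℕ ∘ g) j∈) (sym (toℕ-fromℕ< l<m))))
  ... | no  l≮m = l₀ , λ {j} j∈ →
    contradiction (subst (_< m) (∈fibre⁻ (toℕ ∘ g) j∈) (toℕ<n (g j))) l≮m

  window-toℕ-bound : Fin m → {φ : Subset n → ℚ} → Monotone φ → Subadditive φ → ∀ {B} →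
    (∀ l → φ (part g l) ℚ.≤ B) → ∀ a t → φ (window (toℕ ∘ g) a t) ℚ.≤ ℕ→ℚ (suc t) * B
  window-toℕ-bound l₀ {φ} mono sub {B} φ-part≤B = window-bound (toℕ ∘ g) mono sub φ-fibre≤B
    where
    φ-fibre≤B : ∀ l → φ (fibre (toℕ ∘ g) l) ℚ.≤ B
    φ-fibre≤B l with fibre-toℕ⊆part l₀ l
    ... | l′ , fibre⊆part = ℚ.≤-trans (mono _ _ fibre⊆part) (φ-part≤B l′)

m<m/n*n+n : ∀ m n .{{_ : NonZero n}} → m < m / n ℕ.* n ℕ.+ n
m<m/n*n+n m n = begin-strict
  m                        ≡⟨ m≡m%n+[m/n]*n m n ⟩
  m % n ℕ.+ m / n ℕ.* n    <⟨ ℕ.+-monoˡ-< (m / n ℕ.* n) (m%n<n m n) ⟩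
  n ℕ.+ m / n ℕ.* n        ≡⟨ ℕ.+-comm n _ ⟩
  m / n ℕ.* n ℕ.+ n        ∎
  where open ℕ.≤-Reasoning

module _ {n m} (k s : ℕ) .{{_ : NonZero s}} (g : Fin n → Fin m) (m≤k*s : m ≤ k ℕ.* s) where

  group : Fin n → Fin k
  group j = fromℕ< (m<n*o⇒m/o<n (ℕ.<-≤-trans (toℕ<n (g j)) m≤k*s))

  part-group⊆window : ∀ i → part group i ⊆ window (toℕ ∘ g) (toℕ i ℕ.* s) s
  part-group⊆window i {j} j∈ = ∈window (toℕ ∘ g) (toℕ i ℕ.* s) s lower upper
    where
    l = toℕ (g j)
    l/s≡i : l / s ≡ toℕ i
    l/s≡i = trans (sym (toℕ-fromℕ< _)) (cong toℕ (∈part⁻ group j∈))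
    lower : toℕ i ℕ.* s ≤ l
    lower = subst (λ a → a ℕ.* s ≤ l) l/s≡i (m/n*n≤m l s)
    upper : l < toℕ i ℕ.* s ℕ.+ s
    upper = subst (λ a → l < a ℕ.* s ℕ.+ s) l/s≡i (m<m/n*n+n l s)

module _ {n m} {c : Subset n → ℚ} {p : Fin n → ℚ} (c≥0 : ∀ X → 0ℚ ℚ.≤ c X)
         (p≥0 : ∀ j → 0ℚ ℚ.≤ p j) (g : Fin n → Fin m) (l₀ : Fin m) where

  maxSetup-group≤[1+s]*schedCost : Monotone c → Subadditive c →
    ∀ k s .{{_ : NonZero s}} (m≤k*s : m ≤ k ℕ.* s) →
    maxSetup c (group k s g m≤k*s) ℚ.≤ ℕ→ℚ (suc s) * schedCost c p g
  maxSetup-group≤[1+s]*schedCost c-mono c-sub k s m≤k*s = maxFin-lub k (ℕ→ℚ-*-nonNeg (suc s) (maxFin-nonNeg m _)) λ i → begin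
    c (part (group k s g m≤k*s) i)             ≤⟨ c-mono _ _ (part-group⊆window k s g m≤k*s i) ⟩
    c (window (toℕ ∘ g) (toℕ i ℕ.* s) s)       ≤⟨ window-toℕ-bound g l₀ c-mono c-sub (c-part≤schedCost c≥0 p≥0 g) _ s ⟩
    ℕ→ℚ (suc s) * schedCost c p g              ∎
    where open ℚ.≤-Reasoning

  pSum≤[1+m]*schedCost : ∀ X → pSum p X ℚ.≤ ℕ→ℚ (suc m) * schedCost c p g
  pSum≤[1+m]*schedCost X = begin
    pSum p X                        ≤⟨ pSum-monotone p≥0 X _ (λ {j} _ → ∈window (toℕ ∘ g) 0 m ℕ.z≤n (toℕ<n (g j))) ⟩
    pSum p (window (toℕ ∘ g) 0 m)   ≤⟨ window-toℕ-bound g l₀ (pSum-monotone p≥0) (pSum-subadditive p≥0) (pSum-part≤schedCost c≥0 p≥0 g) 0 m ⟩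
    ℕ→ℚ (suc m) * schedCost c p g   ∎
    where open ℚ.≤-Reasoning

completion-time≤ : ∀ {n} {c : Subset n → ℚ} {p : Fin n → ℚ} {q X T O} .{{_ : NonZero q}} {a b d} →
  0ℚ ℚ.≤ O → BatchCompletion c p q X T →
  c X ℚ.≤ ℕ→ℚ a * O → pSum p X ℚ.≤ ℕ→ℚ b * O → pMax p X ℚ.≤ O →
  q ℕ.* a ℕ.+ b ℕ.+ q ≤ q ℕ.* d → T ℚ.≤ ℕ→ℚ d * O
completion-time≤ {c = c} {p} {q} {X} {T} {O} {a} {b} {d} O≥0 (_ , T≤) cX≤ pX≤ pMaxX≤ coeff≤ =
  ℕ→ℚ-*-cancelˡ-≤ q (begin
    ℕ→ℚ q * T                                            ≤⟨ T≤ ⟩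
    ℕ→ℚ q * c X + pSum p X + ℕ→ℚ q * pMax p X            ≤⟨ ℚ.+-mono-≤ (ℚ.+-mono-≤ (ℕ→ℚ-*-monoˡ-≤ q cX≤) pX≤) (ℕ→ℚ-*-monoˡ-≤ q pMaxX≤) ⟩
    ℕ→ℚ q * (ℕ→ℚ a * O) + ℕ→ℚ b * O + ℕ→ℚ q * O          ≡⟨ collect (ℕ→ℚ q) (ℕ→ℚ a) (ℕ→ℚ b) O ⟩
    (ℕ→ℚ q * ℕ→ℚ a + ℕ→ℚ b + ℕ→ℚ q) * O                  ≡⟨ cong (_* O) (cast-coeff) ⟨
    ℕ→ℚ (q ℕ.* a ℕ.+ b ℕ.+ q) * O                        ≤⟨ ℚ.*-monoʳ-≤-nonNeg O {{ℚ.nonNegative O≥0}} (ℕ→ℚ-mono-≤ coeff≤) ⟩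
    ℕ→ℚ (q ℕ.* d) * O                                    ≡⟨ cong (_* O) (ℕ→ℚ-* q d) ⟩
    ℕ→ℚ q * ℕ→ℚ d * O                                    ≡⟨ ℚ.*-assoc (ℕ→ℚ q) (ℕ→ℚ d) O ⟩
    ℕ→ℚ q * (ℕ→ℚ d * O)                                  ∎)
  where
  open ℚ.≤-Reasoning
  open +-*-Solver
  collect : ∀ x y z o → x * (y * o) + z * o + x * o ≡ (x * y + z + x) * o
  collect = solve 4 (λ x y z o → x :* (y :* o) :+ z :* o :+ x :* o := (x :* y :+ z :+ x) :* o) refl
  cast-coeff : ℕ→ℚ (q ℕ.* a ℕ.+ b ℕ.+ q) ≡ ℕ→ℚ q * ℕ→ℚ a + ℕ→ℚ b + ℕ→ℚ q
  cast-coeff = begin-equality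
    ℕ→ℚ (q ℕ.* a ℕ.+ b ℕ.+ q)              ≡⟨ ℕ→ℚ-+ (q ℕ.* a ℕ.+ b) q ⟩
    ℕ→ℚ (q ℕ.* a ℕ.+ b) + ℕ→ℚ q            ≡⟨ cong (_+ ℕ→ℚ q) (ℕ→ℚ-+ (q ℕ.* a) b) ⟩
    ℕ→ℚ (q ℕ.* a) + ℕ→ℚ b + ℕ→ℚ q          ≡⟨ cong (λ x → x + ℕ→ℚ b + ℕ→ℚ q) (ℕ→ℚ-* q a) ⟩
    ℕ→ℚ q * ℕ→ℚ a + ℕ→ℚ b + ℕ→ℚ q          ∎

*-self-mono-≤ : ∀ {x y} → 0ℚ ℚ.≤ x → x ℚ.≤ y → x * x ℚ.≤ y * y
*-self-mono-≤ {x} {y} x≥0 x≤y = ℚ.≤-trans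
  (ℚ.*-monoˡ-≤-nonNeg x {{ℚ.nonNegative x≥0}} x≤y)
  (ℚ.*-monoʳ-≤-nonNeg y {{ℚ.nonNegative (ℚ.≤-trans x≥0 x≤y)}} x≤y)

x*x≤C*C*m*[O*O] : ∀ C k {m x O} → 0ℚ ℚ.≤ x → 0ℚ ℚ.≤ O → x ℚ.≤ ℕ→ℚ (C ℕ.* k) * O → k ℕ.* k ≤ m →
  x * x ℚ.≤ ℕ→ℚ C * ℕ→ℚ C * ℕ→ℚ m * (O * O)
x*x≤C*C*m*[O*O] C k {m} {x} {O} x≥0 O≥0 x≤CkO k²≤m = begin
  x * x                                          ≤⟨ *-self-mono-≤ x≥0 x≤CkO ⟩
  ℕ→ℚ (C ℕ.* k) * O * (ℕ→ℚ (C ℕ.* k) * O)        ≡⟨ cong (λ y → y * O * (y * O)) (ℕ→ℚ-* C k) ⟩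
  ℕ→ℚ C * ℕ→ℚ k * O * (ℕ→ℚ C * ℕ→ℚ k * O)        ≡⟨ regroup (ℕ→ℚ C) (ℕ→ℚ k) O ⟩
  ℕ→ℚ C * ℕ→ℚ C * (ℕ→ℚ k * ℕ→ℚ k) * (O * O)      ≡⟨ cong (λ y → ℕ→ℚ C * ℕ→ℚ C * y * (O * O)) (ℕ→ℚ-* k k) ⟨
  ℕ→ℚ C * ℕ→ℚ C * ℕ→ℚ (k ℕ.* k) * (O * O)        ≤⟨ ℚ.*-monoʳ-≤-nonNeg (O * O) {{O²-nonNeg}}
                                                      (ℚ.*-monoˡ-≤-nonNeg (ℕ→ℚ C * ℕ→ℚ C) {{C²-nonNeg}} (ℕ→ℚ-mono-≤ k²≤m)) ⟩
  ℕ→ℚ C * ℕ→ℚ C * ℕ→ℚ m * (O * O)                ∎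
  where
  open ℚ.≤-Reasoning
  open +-*-Solver
  regroup : ∀ c k o → c * k * o * (c * k * o) ≡ c * c * (k * k) * (o * o)
  regroup = solve 3 (λ c k o → c :* k :* o :* (c :* k :* o) := c :* c :* (k :* k) :* (o :* o)) refl
  O²-nonNeg = ℚ.nonNeg*nonNeg⇒nonNeg O {{ℚ.nonNegative O≥0}} O {{ℚ.nonNegative O≥0}}
  C²-nonNeg = ℚ.nonNeg*nonNeg⇒nonNeg (ℕ→ℚ C) {{ℕ→ℚ-nonNeg C}} (ℕ→ℚ C) {{ℕ→ℚ-nonNeg C}}

k≤m/k : ∀ k {m} .{{_ : NonZero k}} → k ℕ.* k ≤ m → k ≤ m / k
k≤m/k k k²≤m = subst (_≤ _ / k) (m*n/n≡m k k) (/-monoˡ-≤ k k²≤m)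

m<[1+k]²⇒m≤k*[2+k] : ∀ k {m} → m < suc k ℕ.* suc k → m ≤ k ℕ.* (2 ℕ.+ k)
m<[1+k]²⇒m≤k*[2+k] k {m} m<[1+k]² = ℕ.s≤s⁻¹ (subst (m <_) ([1+k]²≡1+k*[2+k] k) m<[1+k]²)
  where
  [1+k]²≡1+k*[2+k] : ∀ k → suc k ℕ.* suc k ≡ suc (k ℕ.* (2 ℕ.+ k))
  [1+k]²≡1+k*[2+k] = solve-∀

-- With k = 1 + k′ and q = k + r, the difference between the two sides
-- (after bounding 1 + m by (1 + k)²) is 7k′² + 8k′ + 8rk′ + 4r.
q*[3+k]+[1+m]+q≤q*[9k] : ∀ k q m .{{_ : NonZero k}} → k ≤ q → m < suc k ℕ.* suc k →
  q ℕ.* (3 ℕ.+ k) ℕ.+ suc m ℕ.+ q ≤ q ℕ.* (9 ℕ.* k)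
q*[3+k]+[1+m]+q≤q*[9k] k@(suc k′) q m k≤q m<[1+k]² with ℕ.m≤n⇒∃[o]m+o≡n k≤q
... | r , refl = begin
  q ℕ.* (3 ℕ.+ k) ℕ.+ suc m ℕ.+ q                      ≤⟨ ℕ.+-monoˡ-≤ q (ℕ.+-monoʳ-≤ (q ℕ.* (3 ℕ.+ k)) m<[1+k]²) ⟩
  q ℕ.* (3 ℕ.+ k) ℕ.+ suc k ℕ.* suc k ℕ.+ q            ≤⟨ ℕ.m≤m+n _ slack ⟩
  q ℕ.* (3 ℕ.+ k) ℕ.+ suc k ℕ.* suc k ℕ.+ q ℕ.+ slack  ≡⟨ expand k′ r ⟩
  q ℕ.* (9 ℕ.* k)                                      ∎
  where
  open ℕ.≤-Reasoning
  slack = 7 ℕ.* (k′ ℕ.* k′) ℕ.+ 8 ℕ.* k′ ℕ.+ 8 ℕ.* (r ℕ.* k′) ℕ.+ 4 ℕ.* r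
  expand : ∀ k′ r → let k = suc k′; q = k ℕ.+ r in
    q ℕ.* (3 ℕ.+ k) ℕ.+ suc k ℕ.* suc k ℕ.+ q ℕ.+ (7 ℕ.* (k′ ℕ.* k′) ℕ.+ 8 ℕ.* k′ ℕ.+ 8 ℕ.* (r ℕ.* k′) ℕ.+ 4 ℕ.* r)
      ≡ q ℕ.* (9 ℕ.* k)
  expand = solve-∀

batch-time≤ : ∀ {n m k} {c : Subset n → ℚ} {p : Fin n → ℚ} .{{_ : NonZero k}} →
  (∀ X → 0ℚ ℚ.≤ c X) → Monotone c → Subadditive c → (∀ j → 0ℚ ℚ.≤ p j) →
  k ℕ.* k ≤ m → m < suc k ℕ.* suc k →
  (f : Fin n → Fin k) → (∀ (f′ : Fin n → Fin k) → maxSetup c f ℚ.≤ maxSetup c f′) →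
  {T : Fin k → ℚ} → (∀ i → BatchCompletion c p (m / k) (part f i) (T i)) →
  (g : Fin n → Fin m) → Fin m → ∀ i → T i ℚ.≤ ℕ→ℚ (9 ℕ.* k) * schedCost c p g
batch-time≤ {m = m} {k} {c} {p} c≥0 c-mono c-sub p≥0 k²≤m m<[1+k]² f f-opt T-batch g l₀ i =
  completion-time≤ {c = c} {p} {X = part f i} {{q-nonZero}} (maxFin-nonNeg m _) (T-batch i)
    setup≤
    (pSum≤[1+m]*schedCost c≥0 p≥0 g l₀ (part f i))
    (pMax-lub (maxFin-nonNeg m _) (p≤schedCost c≥0 p≥0 g) (part f i))
    (q*[3+k]+[1+m]+q≤q*[9k] k (m / k) m k≤q m<[1+k]²)
  where
  open ℚ.≤-Reasoning
  k≤q : k ≤ m / k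
  k≤q = k≤m/k k k²≤m
  q-nonZero : NonZero (m / k)
  q-nonZero = ℕ.>-nonZero (ℕ.<-≤-trans (ℕ.>-nonZero⁻¹ k) k≤q)
  m≤k*[2+k] : m ≤ k ℕ.* (2 ℕ.+ k)
  m≤k*[2+k] = m<[1+k]²⇒m≤k*[2+k] k m<[1+k]²
  setup≤ : c (part f i) ℚ.≤ ℕ→ℚ (3 ℕ.+ k) * schedCost c p g
  setup≤ = begin
    c (part f i)                               ≤⟨ term≤maxFin k _ i ⟩
    maxSetup c f                               ≤⟨ f-opt _ ⟩
    maxSetup c (group k (2 ℕ.+ k) g m≤k*[2+k])  ≤⟨ maxSetup-group≤[1+s]*schedCost c≥0 p≥0 g l₀ c-mono c-sub k (2 ℕ.+ k) m≤k*[2+k] ⟩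
    ℕ→ℚ (3 ℕ.+ k) * schedCost c p g            ∎

theorem8 : Σ ℚ λ C → (n m : ℕ) → 2 ≤ m → m ≤ n →
    (c : Subset n → ℚ) → (∀ X → 0ℚ ℚ.≤ c X) → Monotone c → Subadditive c →
    (p : Fin n → ℚ) → (∀ j → 0ℚ ℚ.≤ p j) →
    (k : ℕ) → k ℕ.* k ≤ m → m < suc k ℕ.* suc k →
    .{{_ : ℕ.NonZero k}} →
    (f : Fin n → Fin k) → (∀ (f′ : Fin n → Fin k) → maxSetup c f ℚ.≤ maxSetup c f′) →
    (T : Fin k → ℚ) → (∀ i → BatchCompletion c p (m / k) (part f i) (T i)) →
    (g : Fin n → Fin m) →
    maxFin k T * maxFin k T ℚ.≤ C * C * ℕ→ℚ m * (schedCost c p g * schedCost c p g)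
theorem8 = ℕ→ℚ 9 , λ n m 2≤m _ c c≥0 c-mono c-sub p p≥0 k k²≤m m<[1+k]² f f-opt T T-batch g →
  x*x≤C*C*m*[O*O] 9 k (maxFin-nonNeg k T) (maxFin-nonNeg m _)
    (maxFin-lub k (ℕ→ℚ-*-nonNeg (9 ℕ.* k) (maxFin-nonNeg m _))
      (batch-time≤ c≥0 c-mono c-sub p≥0 k²≤m m<[1+k]² f f-opt T-batch g (fromℕ< (ℕ.<-≤-trans ℕ.0<1+n 2≤m))))
    k²≤m
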